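{- Let $m \neq \ell$. Given sets $S\subseteq[n-1]$ and $T\subseteq[n-1]$, and fixed $0\leq m, \ell\leq n-2$, the number of prime parking functions $\pi\in\mathrm{PPF}_n$ with $\mathrm{Set}_{m}(\pi)=S$ and $\mathrm{Set}_{\ell}(\pi)=T$ is $$|\{\pi \in \mathrm{PPF}_n : \mathrm{Set}_{m}(\pi)=S, \mathrm{Set}_{\ell}(\pi)=T\}| =(n-3)^{n-1-|S|-|T|}.$$
   Context: A parking function of length $n$ is a sequence of positive integers whose increasing rearrangement $\lambda$ satisfies $\lambda_i\le i$; it is prime if removing any instance of 1 yields a parking function of length $n-1$. $\mathrm{PPF}_n$ denotes the set of prime parking functions of length $n$. A tuple $(x_1,\dots,x_n)$ has an $\ell$-forward difference at $i\in[n-1]$ if $x_{i+1}-x_i\equiv\ell\pmod{n-1}$; $\mathrm{Set}_\ell(\pi)$ is the set of indices $i$ at which $\pi$ has an $\ell$-forward difference.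
   Formalization: The sets S and T are also assumed disjoint, that is, S ∩ T = ∅. The statement above fails without it. -}

module Defs where

open import Data.Nat using (ℕ; zero; suc; _≤_; _∸_; _^_)
open import Data.Nat.Properties using (≤-decTotalOrder)
open import Data.Integer as ℤ using (ℤ; +_; _-_)
open import Data.Nat.Divisibility using (_∣?_)
open import Data.Fin using (Fin; toℕ; inject₁) renaming (suc to fsuc)
open import Data.Fin.Subset using (Subset)
open import Data.List using (List; length; lookup; removeAt)
open import Data.List.Relation.Unary.All using (All)
open import Data.List.Relation.Unary.Unique.Propositional using (Unique)
open import Data.List.Membership.Propositional using (_∈_)
open import Data.Vec as Vec using (Vec; toList; tabulate)
open import Data.Product using (Σ; _×_)
open import Function.Bundles using (_⇔_)
open import Relation.Binary.PropositionalEquality using (_≡_)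
open import Relation.Nullary using (does)

open import Data.List.Sort ≤-decTotalOrder using (sort)

-- A parking function (on lists of naturals): a sequence of positive
-- integers whose increasing rearrangement λ satisfies λ_i ≤ i
-- (positions are 1-based, so the 0-based index i gets bound i+1).
IsParkingFunction : List ℕ → Set
IsParkingFunction xs =
  All (1 ≤_) xs ×
  ((i : Fin (length (sort xs))) → lookup (sort xs) i ≤ suc (toℕ i))

IsPrimeParkingFunction : List ℕ → Set
IsPrimeParkingFunction xs =
  IsParkingFunction xs ×
  ((j : Fin (length xs)) → lookup xs j ≡ 1 → IsParkingFunction (removeAt xs j))

PPF : (n : ℕ) → Vec ℕ n → Set
PPF n π = IsPrimeParkingFunction (toList π)

-- For a tuple x of length n = suc k, Set_ℓ(x) ⊆ [n-1] = [k], encoded as a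
-- Subset k where Fin index i stands for the position i+1.  Position i+1 is
-- in the set iff x_{i+2} - x_{i+1} ≡ ℓ (mod n-1), i.e. (n-1) ∣ x_{i+2} - x_{i+1} - ℓ
-- in ℤ (integer divisibility i ∣ j is |i| ∣ |j| in ℕ, as in Data.Integer.Divisibility).
SetDiff : (k : ℕ) → (ℓ : ℕ) → Vec ℕ (suc k) → Subset k
SetDiff k ℓ x = tabulate λ i →
  does (k ∣? ℤ.∣ (+ Vec.lookup x (fsuc i) - + Vec.lookup x (inject₁ i)) - + ℓ ∣)

HasCardinality : {A : Set} → (A → Set) → ℕ → Set
HasCardinality {A} P N =
  Σ (List A) λ L → Unique L × ((x : A) → (x ∈ L) ⇔ P x) × length L ≡ N

{-# OPTIONS --safe #-}
module Submission where

-- Write K = n − 1 and let C(v) be the number of entries at most v.  A tuple of length K + 1 is a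
-- prime parking function iff its entries are positive and C(v) > v for 1 ≤ v ≤ K (removing a 1
-- lowers each count by one); in particular its entries lie in [1, K].  The tuples with entries in
-- [1, K] whose forward differences are congruent mod K to a given d ∈ [0, K)^K are exactly the K
-- cyclic shifts x ↦ x − s (mod K, represented in [1, K]) of one of them, and exactly one shift is
-- prime (the cyclic lemma).  Shifting by the last minimiser s of C(w) − w on [0, K] turns the count
-- at v into C(s + v) − C(s) if s + v ≤ K and into (K + 1) + C(s + v − K) − C(s) otherwise, and
-- minimality makes both exceed v.  If x and its shift by 0 < s < K were both prime, the count of
-- the shift at K − s and the count of x at s would exceed K − s and s, yet they add up to C(K) = K + 1.
-- Hence reducing forward differences mod K is a bijection from PPF_n onto [0, K)^K, under which
-- Set_e(π) becomes the level set {i : d_i = e}.  For disjoint S and T the positions in S and T are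
-- forced to m and ℓ, and each of the other K − |S| − |T| positions takes one of K − 2 residues.

open import Data.Bool.Base using (Bool; true; false; T; if_then_else_)
open import Data.Bool.Properties using (T-≡)
open import Data.Fin.Base using (Fin; toℕ; fromℕ<; inject₁) renaming (zero to fzero; suc to fsuc)
open import Data.Fin.Properties using (toℕ<n; toℕ-fromℕ<)
open import Data.Fin.Subset using (Subset; _∩_; ∣_∣; Empty)
open import Data.Fin.Subset.Properties using (drop-∷-Empty)
open import Data.Integer.Base as ℤ using (ℤ; +_; _-_; -_; 0ℤ; 1ℤ)
open import Data.Integer.DivMod using (_%ℕ_; _/ℕ_; n%ℕd<d; a≡a%ℕn+[a/ℕn]*n)
open import Data.Integer.Divisibility.Signed
  using (_∣_; divides; ∣m⇒∣-m; ∣m∣n⇒∣m+n; ∣m∣n⇒∣m-n; ∣⇒∣ᵤ; ∣ᵤ⇒∣)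
import Data.Integer.Properties as ℤ
import Data.Integer.Tactic.RingSolver as ℤ-Solver
open import Data.List.Base
  using (List; []; _∷_; _++_; length; lookup; removeAt; map; filter; upTo; cartesianProductWith)
open import Data.List.Membership.Propositional using (_∈_)
open import Data.List.Membership.Propositional.Properties
  using ( ∈-lookup; ∈-upTo⁺; ∈-upTo⁻; ∈-filter⁺; ∈-filter⁻; ∈-map⁺; ∈-map⁻
        ; ∈-cartesianProductWith⁺; ∈-cartesianProductWith⁻)
open import Data.List.Properties
  using ( length-removeAt′; length-map; length-++; length-upTo; map-∘; map-id-local
        ; filter-all; filter-accept; filter-reject)
open import Data.List.Relation.Binary.Permutation.Propositional using (_↭_; refl; prep; swap; trans)
open import Data.List.Relation.Binary.Permutation.Propositional.Properties using (↭-length)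
open import Data.List.Relation.Unary.All as All using (All; []; _∷_)
open import Data.List.Relation.Unary.All.Properties using (map⁺)
open import Data.List.Relation.Unary.AllPairs using ([]; _∷_)
open import Data.List.Relation.Unary.Any using (here; there)
open import Data.List.Relation.Unary.Linked as Linked using (Linked)
open import Data.List.Relation.Unary.Linked.Properties using (Linked⇒All)
open import Data.List.Relation.Unary.Unique.Propositional using (Unique)
import Data.List.Relation.Unary.Unique.Propositional.Properties as Unique
open import Data.Nat.Base
  using (ℕ; zero; suc; NonZero; >-nonZero⁻¹; _+_; _*_; _^_; _∸_; _≤_; _<_; _≤ᵇ_; z≤n; s≤s; s≤s⁻¹; z<s)
open import Data.Nat.Divisibility using (∣⇒≤; _∣?_) renaming (_∣_ to _∣ℕ_)
open import Data.Nat.Properties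
open import Algebra.Properties.CommutativeSemigroup +-commutativeSemigroup using (x∙yz≈y∙xz; xy∙z≈yz∙x; interchange)
open import Data.Nat.Tactic.RingSolver using (solve-∀)
open import Data.Product using (∃-syntax; _×_; _,_; proj₁; proj₂)
import Data.Product as Product
open import Data.Sum using (_⊎_; inj₁; inj₂; [_,_])
import Data.Sum as Sum
open import Data.Vec.Base as Vec using (Vec; []; _∷_; here; toList; tabulate)
open import Data.Vec.Properties
  using (∷-injective; tabulate∘lookup; tabulate-cong; lookup∘tabulate; lookup-map; toList-map; length-toList)
import Data.Vec.Relation.Unary.All.Properties as Allᵛ
open import Function.Base using (_∘_)
open import Function.Bundles using (_⇔_; mk⇔; Equivalence)
open import Function.Properties.Equivalence using () renaming (trans to ⇔-trans)
open import Level using (0ℓ)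
open import Relation.Binary.Bundles using (Setoid)
open import Relation.Binary.Definitions using (DecidableEquality)
open import Relation.Binary.PropositionalEquality
  using (_≡_; _≢_; refl; sym; cong; cong₂; subst; module ≡-Reasoning) renaming (trans to ≡-trans)
import Relation.Binary.Reasoning.Setoid as SetoidReasoning
open import Relation.Nullary.Decidable using (Dec; does; yes; no; ¬?; does-⇔)
open import Relation.Nullary.Negation using (¬_; contradiction)
open import Relation.Nullary.Reflects using (ofʸ; ofⁿ)

open import Data.List.Sort ≤-decTotalOrder using (sort; sort-↭; sort-↗)
open import Defs

private variable
  A B : Set

𝟙 : Bool → ℕ
𝟙 true  = 1
𝟙 false = 0

count : (A → Bool) → List A → ℕ
count p []       = 0
count p (x ∷ xs) = 𝟙 (p x) + count p xs

module _ {p : A → Bool} where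

  count-↭ : ∀ {xs ys} → xs ↭ ys → count p xs ≡ count p ys
  count-↭ refl                = refl
  count-↭ (prep x xs↭ys)      = cong (_+_ (𝟙 (p x))) (count-↭ xs↭ys)
  count-↭ (swap x y xs↭ys)    = ≡-trans (cong (λ c → 𝟙 (p x) + (𝟙 (p y) + c)) (count-↭ xs↭ys))
                                        (x∙yz≈y∙xz (𝟙 (p x)) (𝟙 (p y)) _)
  count-↭ (trans xs↭ys ys↭zs) = ≡-trans (count-↭ xs↭ys) (count-↭ ys↭zs)

  count-removeAt : ∀ xs (i : Fin (length xs)) →
                   count p xs ≡ 𝟙 (p (lookup xs i)) + count p (removeAt xs i)
  count-removeAt (x ∷ xs) fzero    = refl
  count-removeAt (x ∷ xs) (fsuc i) = ≡-trans (cong (_+_ (𝟙 (p x))) (count-removeAt xs i))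
                                             (x∙yz≈y∙xz (𝟙 (p x)) (𝟙 (p (lookup xs i))) _)

  count≤length : ∀ xs → count p xs ≤ length xs
  count≤length []       = z≤n
  count≤length (x ∷ xs) with p x
  ... | true  = s≤s (count≤length xs)
  ... | false = m≤n⇒m≤1+n (count≤length xs)

  count-none : ∀ {xs} → All (λ x → p x ≡ false) xs → count p xs ≡ 0
  count-none []                    = refl
  count-none (px ∷ pxs) rewrite px = count-none pxs

  count-all : ∀ {xs} → All (λ x → p x ≡ true) xs → count p xs ≡ length xs
  count-all []                    = refl
  count-all (px ∷ pxs) rewrite px = cong suc (count-all pxs)

  length≤count⇒all : ∀ xs → length xs ≤ count p xs → All (T ∘ p) xs
  length≤count⇒all []       _ = []
  length≤count⇒all (x ∷ xs) n≤c with p x in px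
  ... | true  = Equivalence.from T-≡ px ∷ length≤count⇒all xs (s≤s⁻¹ n≤c)
  ... | false = contradiction (≤-trans n≤c (count≤length xs)) (<-irrefl refl)

  0<count⇒∃ : ∀ xs → 0 < count p xs → ∃[ i ] T (p (lookup xs i))
  0<count⇒∃ (x ∷ xs) 0<c with p x in px
  ... | true  = fzero , Equivalence.from T-≡ px
  ... | false = let i , pxᵢ = 0<count⇒∃ xs 0<c in fsuc i , pxᵢ

count-mono : ∀ {p q : A → Bool} → (∀ x → 𝟙 (p x) ≤ 𝟙 (q x)) → ∀ xs → count p xs ≤ count q xs
count-mono p≤q []       = z≤n
count-mono p≤q (x ∷ xs) = +-mono-≤ (p≤q x) (count-mono p≤q xs)

count-map : ∀ (p : B → Bool) (f : A → B) xs → count p (map f xs) ≡ count (p ∘ f) xs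
count-map p f []       = refl
count-map p f (x ∷ xs) = cong (_+_ (𝟙 (p (f x)))) (count-map p f xs)

count-+ : ∀ {p q r : A → Bool} k {xs} → All (λ x → 𝟙 (p x) + 𝟙 (q x) ≡ k + 𝟙 (r x)) xs →
          count p xs + count q xs ≡ k * length xs + count r xs
count-+ k {[]} [] = sym (cong (_+ 0) (*-zeroʳ k))
count-+ {p = p} {q} {r} k {x ∷ xs} (eq ∷ eqs) = begin
  (𝟙 (p x) + count p xs) + (𝟙 (q x) + count q xs) ≡⟨ interchange (𝟙 (p x)) _ _ _ ⟩
  (𝟙 (p x) + 𝟙 (q x)) + (count p xs + count q xs) ≡⟨ cong₂ _+_ eq (count-+ k eqs) ⟩
  (k + 𝟙 (r x)) + (k * length xs + count r xs)     ≡⟨ regroup k (𝟙 (r x)) (length xs) _ ⟩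
  k * suc (length xs) + (𝟙 (r x) + count r xs)    ∎
  where
  open ≡-Reasoning
  regroup : ∀ k a n c → (k + a) + (k * n + c) ≡ k * suc n + (a + c)
  regroup = solve-∀

≤ᵇ-true : ∀ {m n} → m ≤ n → (m ≤ᵇ n) ≡ true
≤ᵇ-true m≤n = Equivalence.to T-≡ (≤⇒≤ᵇ m≤n)

≤ᵇ-false : ∀ {m n} → n < m → (m ≤ᵇ n) ≡ false
≤ᵇ-false {m} {n} n<m with m ≤ᵇ n | ≤ᵇ-reflects-≤ m n
... | false | _       = refl
... | true  | ofʸ m≤n = contradiction m≤n (<⇒≱ n<m)

atMost : ℕ → List ℕ → ℕ
atMost v = count (_≤ᵇ v)

atMost-mono : ∀ {v w} → v ≤ w → ∀ xs → atMost v xs ≤ atMost w xs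
atMost-mono {v} {w} v≤w = count-mono indicator-mono
  where
  indicator-mono : ∀ x → 𝟙 (x ≤ᵇ v) ≤ 𝟙 (x ≤ᵇ w)
  indicator-mono x with x ≤ᵇ v | ≤ᵇ-reflects-≤ x v
  ... | false | _       = z≤n
  ... | true  | ofʸ x≤v rewrite ≤ᵇ-true (≤-trans x≤v v≤w) = ≤-refl

atMost-removeAt-1 : ∀ {v} xs (j : Fin (length xs)) → lookup xs j ≡ 1 →
                    atMost (suc v) xs ≡ suc (atMost (suc v) (removeAt xs j))
atMost-removeAt-1 {v} xs j xⱼ≡1 =
  ≡-trans (count-removeAt xs j) (cong (λ x → 𝟙 (x ≤ᵇ suc v) + atMost (suc v) (removeAt xs j)) xⱼ≡1)

sorted-lookup≤⇔ : ∀ {v ys} → Linked _≤_ ys → (i : Fin (length ys)) →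
                  lookup ys i ≤ v ⇔ toℕ i < atMost v ys
sorted-lookup≤⇔ {v} {y ∷ ys} ys↗ i with y ≤ᵇ v | ≤ᵇ-reflects-≤ y v | i
... | true  | ofʸ y≤v | fzero  = mk⇔ (λ _ → s≤s z≤n) (λ _ → y≤v)
... | true  | ofʸ _   | fsuc j = mk⇔ (s≤s ∘ to) (from ∘ s≤s⁻¹)
  where open Equivalence (sorted-lookup≤⇔ (Linked.tail ys↗) j)
... | false | ofⁿ y≰v | j      =
  mk⇔ (λ yⱼ≤v → contradiction (≤-trans (All.lookup y≤ (∈-lookup j)) yⱼ≤v) y≰v)
      (λ j<0 → contradiction (≤-trans j<0 (≤-reflexive none≤v)) λ ())
  where
  y≤ : All (y ≤_) (y ∷ ys)
  y≤ = Linked⇒All ≤-trans ≤-refl ys↗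
  none≤v : atMost v ys ≡ 0
  none≤v = count-none (All.map (λ y≤x → ≤ᵇ-false (≰⇒> (λ x≤v → y≰v (≤-trans y≤x x≤v)))) (All.tail y≤))

-- Parking functions via counts

All-removeAt : ∀ {P : A → Set} xs (i : Fin (length xs)) → All P xs → All P (removeAt xs i)
All-removeAt (x ∷ xs) fzero    (_ ∷ pxs)  = pxs
All-removeAt (x ∷ xs) (fsuc i) (px ∷ pxs) = px ∷ All-removeAt xs i pxs

ParkingCounts : List ℕ → Set
ParkingCounts xs = All (1 ≤_) xs × (∀ {i} → i < length xs → i < atMost (suc i) xs)

PrimeParkingCounts : List ℕ → Set
PrimeParkingCounts xs = All (1 ≤_) xs × (∀ {v} → 0 < v → v < length xs → v < atMost v xs)

parking⇔counts : ∀ xs → IsParkingFunction xs ⇔ ParkingCounts xs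
parking⇔counts xs = mk⇔ (λ (pos , bounded) → pos , to bounded) (λ (pos , counts) → pos , from counts)
  where
  length-sort : length (sort xs) ≡ length xs
  length-sort = ↭-length (sort-↭ xs)

  lookup≤⇔ : ∀ i → lookup (sort xs) i ≤ suc (toℕ i) ⇔ toℕ i < atMost (suc (toℕ i)) xs
  lookup≤⇔ i = subst (λ c → lookup (sort xs) i ≤ suc (toℕ i) ⇔ toℕ i < c)
                     (count-↭ (sort-↭ xs)) (sorted-lookup≤⇔ (sort-↗ xs) i)

  to : (∀ i → lookup (sort xs) i ≤ suc (toℕ i)) → ∀ {i} → i < length xs → i < atMost (suc i) xs
  to bounded {i} i<n = subst (λ j → j < atMost (suc j) xs) (toℕ-fromℕ< i<n′)
                             (Equivalence.to (lookup≤⇔ (fromℕ< i<n′)) (bounded _))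
    where i<n′ = subst (i <_) (sym length-sort) i<n

  from : (∀ {i} → i < length xs → i < atMost (suc i) xs) → ∀ i → lookup (sort xs) i ≤ suc (toℕ i)
  from counts i = Equivalence.from (lookup≤⇔ i) (counts (subst (toℕ i <_) length-sort (toℕ<n i)))

prime⇔counts : ∀ xs → 2 ≤ length xs → IsPrimeParkingFunction xs ⇔ PrimeParkingCounts xs
prime⇔counts xs 2≤n = mk⇔ to from
  where
  to : IsPrimeParkingFunction xs → PrimeParkingCounts xs
  to (park , removal) = pos , counts
    where
    pos = proj₁ (Equivalence.to (parking⇔counts xs) park)
    one = 0<count⇒∃ xs (proj₂ (Equivalence.to (parking⇔counts xs) park) (<-≤-trans z<s 2≤n))
    j = proj₁ one
    xⱼ≡1 : lookup xs j ≡ 1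
    xⱼ≡1 = ≤-antisym (≤ᵇ⇒≤ _ 1 (proj₂ one)) (All.lookup pos (∈-lookup j))
    counts : ∀ {v} → 0 < v → v < length xs → v < atMost v xs
    counts {suc v} _ v<n = ≤-trans (s≤s (removedCounts v<n′)) (≤-reflexive (sym (atMost-removeAt-1 xs j xⱼ≡1)))
      where
      removedCounts = proj₂ (Equivalence.to (parking⇔counts _) (removal j xⱼ≡1))
      v<n′ : v < length (removeAt xs j)
      v<n′ = s≤s⁻¹ (≤-trans v<n (≤-reflexive (length-removeAt′ xs j)))

  from : PrimeParkingCounts xs → IsPrimeParkingFunction xs
  from (pos , counts) = Equivalence.from (parking⇔counts xs) (pos , parkCounts) , removal
    where
    parkCounts : ∀ {i} → i < length xs → i < atMost (suc i) xs
    parkCounts {zero}  _   = <-trans z<s (counts z<s 2≤n)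
    parkCounts {suc i} i<n = <-≤-trans (counts z<s i<n) (atMost-mono (n≤1+n _) xs)
    removal : ∀ j → lookup xs j ≡ 1 → IsParkingFunction (removeAt xs j)
    removal j xⱼ≡1 = Equivalence.from (parking⇔counts _) (All-removeAt xs j pos , λ {i} i<n →
      s≤s⁻¹ (≤-trans (counts z<s (≤-trans (s≤s i<n) (≤-reflexive (sym (length-removeAt′ xs j)))))
                     (≤-reflexive (atMost-removeAt-1 xs j xⱼ≡1))))

-- The cyclic lemma

record LastArgMin (f : ℕ → ℕ) (N : ℕ) : Set where
  field
    arg     : ℕ
    arg≤N   : arg ≤ N
    minimal : ∀ {w} → w ≤ N → f arg ≤ f w
    last    : ∀ {w} → arg < w → w ≤ N → f arg < f w

m≤1+n⇒m≤n∨m≡1+n : ∀ {m n} → m ≤ suc n → m ≤ n ⊎ m ≡ suc n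
m≤1+n⇒m≤n∨m≡1+n = Sum.map₁ s≤s⁻¹ ∘ m≤n⇒m<n∨m≡n

lastArgMin : ∀ f N → LastArgMin f N
lastArgMin f zero = record
  { arg     = 0
  ; arg≤N   = z≤n
  ; minimal = λ { z≤n → ≤-refl }
  ; last    = λ 0<w w≤0 → contradiction (<-≤-trans 0<w w≤0) (<-irrefl refl)
  }
lastArgMin f (suc N) with lastArgMin f N
... | previous with f (suc N) ≤? f (LastArgMin.arg previous)
...   | yes new≤ = record
  { arg     = suc N
  ; arg≤N   = ≤-refl
  ; minimal = [ (λ w≤N → ≤-trans new≤ (minimal w≤N)) , (λ { refl → ≤-refl }) ] ∘ m≤1+n⇒m≤n∨m≡1+n
  ; last    = λ N<w w≤N → contradiction (<-≤-trans N<w w≤N) (<-irrefl refl)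
  }
  where open LastArgMin previous
...   | no new≰ = record
  { arg     = arg
  ; arg≤N   = m≤n⇒m≤1+n arg≤N
  ; minimal = [ minimal , (λ { refl → <⇒≤ (≰⇒> new≰) }) ] ∘ m≤1+n⇒m≤n∨m≡1+n
  ; last    = λ arg<w → [ last arg<w , (λ { refl → ≰⇒> new≰ }) ] ∘ m≤1+n⇒m≤n∨m≡1+n
  }
  where open LastArgMin previous

module Rotation (K : ℕ) where

  InRange : ℕ → Set
  InRange x = 1 ≤ x × x ≤ K

  rot : ℕ → ℕ → ℕ
  rot s x = if x ≤ᵇ s then x + (K ∸ s) else x ∸ s

  rot-≤ : ∀ {s x} → x ≤ s → rot s x ≡ x + (K ∸ s)
  rot-≤ x≤s rewrite ≤ᵇ-true x≤s = refl

  rot-> : ∀ {s x} → s < x → rot s x ≡ x ∸ s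
  rot-> s<x rewrite ≤ᵇ-false s<x = refl

  rot-inRange : ∀ {s x} → s < K → InRange x → InRange (rot s x)
  rot-inRange {s} {x} s<K (1≤x , x≤K) with x ≤? s
  ... | yes x≤s rewrite rot-≤ x≤s =
    ≤-trans 1≤x (m≤m+n x (K ∸ s)) ,
    ≤-trans (+-monoˡ-≤ (K ∸ s) x≤s) (≤-reflexive (m+[n∸m]≡n (<⇒≤ s<K)))
  ... | no x≰s rewrite rot-> (≰⇒> x≰s) = m<n⇒0<n∸m (≰⇒> x≰s) , ≤-trans (m∸n≤m x s) x≤K

  atMost-0 : ∀ {xs} → All InRange xs → atMost 0 xs ≡ 0
  atMost-0 inRange = count-none (All.map (≤ᵇ-false ∘ proj₁) inRange)

  atMost-K : ∀ {xs} → All InRange xs → atMost K xs ≡ length xs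
  atMost-K inRange = count-all (All.map (≤ᵇ-true ∘ proj₂) inRange)

  prime⇒inRange : 0 < K → ∀ {xs} → length xs ≡ suc K → PrimeParkingCounts xs → All InRange xs
  prime⇒inRange 0<K {xs} n≡1+K (pos , counts) =
    All.zip (pos , All.map (≤ᵇ⇒≤ _ K) (length≤count⇒all xs (≤-trans (≤-reflexive n≡1+K) K<c)))
    where K<c = counts 0<K (≤-reflexive (sym n≡1+K))

  𝟙-rot-low : ∀ {s v x} → v ≤ K ∸ s → 1 ≤ x → 𝟙 (rot s x ≤ᵇ v) + 𝟙 (x ≤ᵇ s) ≡ 0 + 𝟙 (x ≤ᵇ s + v)
  𝟙-rot-low {s} {v} {x} v≤K-s 1≤x with x ≤? s
  ... | yes x≤s
    rewrite rot-≤ x≤s | ≤ᵇ-true x≤s | ≤ᵇ-true (≤-trans x≤s (m≤m+n s v))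
          | ≤ᵇ-false (<-≤-trans (s≤s v≤K-s) (+-monoˡ-≤ (K ∸ s) 1≤x)) = refl
  ... | no x≰s rewrite rot-> (≰⇒> x≰s) | ≤ᵇ-false (≰⇒> x≰s) =
    ≡-trans (+-identityʳ _) (cong 𝟙 (does-⇔ x∸s≤v⇔x≤s+v (x ∸ s ≤? v) (x ≤? s + v)))
    where
    x∸s≤v⇔x≤s+v : x ∸ s ≤ v ⇔ x ≤ s + v
    x∸s≤v⇔x≤s+v = mk⇔ (λ x∸s≤v → ≤-trans (m≤n+m∸n x s) (+-monoʳ-≤ s x∸s≤v)) (m≤n+o⇒m∸n≤o x s)

  𝟙-rot-high : ∀ {s w x} → w ≤ s → x ≤ K → 𝟙 (rot s x ≤ᵇ K ∸ s + w) + 𝟙 (x ≤ᵇ s) ≡ 1 + 𝟙 (x ≤ᵇ w)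
  𝟙-rot-high {s} {w} {x} w≤s x≤K with x ≤? s
  ... | yes x≤s rewrite rot-≤ x≤s | ≤ᵇ-true x≤s =
    ≡-trans (+-comm _ 1) (cong (suc ∘ 𝟙) (does-⇔ shifted⇔ (x + (K ∸ s) ≤? K ∸ s + w) (x ≤? w)))
    where
    shifted⇔ : x + (K ∸ s) ≤ K ∸ s + w ⇔ x ≤ w
    shifted⇔ = mk⇔ (λ h → +-cancelʳ-≤ (K ∸ s) x w (≤-trans h (≤-reflexive (+-comm (K ∸ s) w))))
                   (λ x≤w → ≤-trans (+-monoˡ-≤ (K ∸ s) x≤w) (≤-reflexive (+-comm w (K ∸ s))))
  ... | no x≰s rewrite rot-> (≰⇒> x≰s) | ≤ᵇ-false (≰⇒> x≰s)
                     | ≤ᵇ-true (≤-trans (∸-monoˡ-≤ s x≤K) (m≤m+n (K ∸ s) w))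
                     | ≤ᵇ-false (≤-<-trans w≤s (≰⇒> x≰s)) = refl

  atMost-rot-low : ∀ {s v xs} → v ≤ K ∸ s → All InRange xs →
                   atMost v (map (rot s) xs) + atMost s xs ≡ atMost (s + v) xs
  atMost-rot-low {s} {v} {xs} v≤K-s inRange =
    ≡-trans (cong (_+ atMost s xs) (count-map (_≤ᵇ v) (rot s) xs))
            (count-+ 0 (All.map (𝟙-rot-low v≤K-s ∘ proj₁) inRange))

  atMost-rot-high : ∀ {s w xs} → w ≤ s → All InRange xs →
                    atMost (K ∸ s + w) (map (rot s) xs) + atMost s xs ≡ length xs + atMost w xs
  atMost-rot-high {s} {w} {xs} w≤s inRange = begin
    atMost (K ∸ s + w) (map (rot s) xs) + atMost s xs ≡⟨ cong (_+ atMost s xs) (count-map (_≤ᵇ K ∸ s + w) (rot s) xs) ⟩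
    count ((_≤ᵇ K ∸ s + w) ∘ rot s) xs + atMost s xs  ≡⟨ count-+ 1 (All.map (𝟙-rot-high w≤s ∘ proj₂) inRange) ⟩
    1 * length xs + atMost w xs                       ≡⟨ cong (_+ atMost w xs) (*-identityˡ (length xs)) ⟩
    length xs + atMost w xs                           ∎
    where open ≡-Reasoning

  atMost-rot-low-bound : ∀ {s v xs} → v ≤ K ∸ s → All InRange xs →
                         atMost s xs + (s + v) < atMost (s + v) xs + s → v < atMost v (map (rot s) xs)
  atMost-rot-low-bound {s} {v} {xs} v≤K-s inRange below = +-cancelˡ-< (atMost s xs + s) v c (begin-strict
    atMost s xs + s + v   ≡⟨ +-assoc (atMost s xs) s v ⟩
    atMost s xs + (s + v) <⟨ below ⟩
    atMost (s + v) xs + s ≡⟨ cong (_+ s) (atMost-rot-low v≤K-s inRange) ⟨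
    c + atMost s xs + s   ≡⟨ xy∙z≈yz∙x c (atMost s xs) s ⟩
    atMost s xs + s + c   ∎)
    where
    open ≤-Reasoning
    c = atMost v (map (rot s) xs)

  atMost-rot-high-bound : ∀ {s w xs} → w ≤ s → s ≤ K → All InRange xs → length xs ≡ suc K →
                          atMost s xs + w ≤ atMost w xs + s → K ∸ s + w < atMost (K ∸ s + w) (map (rot s) xs)
  atMost-rot-high-bound {s} {w} {xs} w≤s s≤K inRange n≡1+K below =
    +-cancelʳ-≤ (atMost s xs + s) (suc (K ∸ s + w)) c (begin
      suc (K ∸ s + w) + (atMost s xs + s) ≡⟨ regroup (K ∸ s) w (atMost s xs) s ⟩
      suc (K ∸ s + s) + (atMost s xs + w) ≡⟨ cong (λ k → suc k + (atMost s xs + w)) (m∸n+n≡m s≤K) ⟩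
      suc K + (atMost s xs + w)           ≤⟨ +-monoʳ-≤ (suc K) below ⟩
      suc K + (atMost w xs + s)           ≡⟨ +-assoc (suc K) (atMost w xs) s ⟨
      suc K + atMost w xs + s             ≡⟨ cong (λ n → n + atMost w xs + s) n≡1+K ⟨
      length xs + atMost w xs + s         ≡⟨ cong (_+ s) (atMost-rot-high w≤s inRange) ⟨
      c + atMost s xs + s                 ≡⟨ +-assoc c (atMost s xs) s ⟩
      c + (atMost s xs + s)               ∎)
    where
    open ≤-Reasoning
    c = atMost (K ∸ s + w) (map (rot s) xs)
    regroup : ∀ r w a s → suc (r + w) + (a + s) ≡ suc (r + s) + (a + w)
    regroup = solve-∀

  private
    unshift : ∀ a {s} w → s ≤ K → a + (K ∸ s) + (s + w) ≡ a + w + K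
    unshift a {s} w s≤K = ≡-trans (regroup a (K ∸ s) s w) (cong (_+_ (a + w)) (m∸n+n≡m s≤K))
      where
      regroup : ∀ a r s w → a + r + (s + w) ≡ a + w + (r + s)
      regroup = solve-∀

    shift-≤ : ∀ {a b s w} → s ≤ K → w ≤ K → a + (K ∸ s) ≤ b + (K ∸ w) → a + w ≤ b + s
    shift-≤ {a} {b} {s} {w} s≤K w≤K h = +-cancelʳ-≤ K (a + w) (b + s) (begin
      a + w + K             ≡⟨ unshift a w s≤K ⟨
      a + (K ∸ s) + (s + w) ≤⟨ +-monoˡ-≤ (s + w) h ⟩
      b + (K ∸ w) + (s + w) ≡⟨ cong (_+_ (b + (K ∸ w))) (+-comm s w) ⟩
      b + (K ∸ w) + (w + s) ≡⟨ unshift b s w≤K ⟩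
      b + s + K             ∎)
      where open ≤-Reasoning

    shift-< : ∀ {a b s w} → s ≤ K → w ≤ K → a + (K ∸ s) < b + (K ∸ w) → a + w < b + s
    shift-< {a} {b} {s} {w} s≤K w≤K h = +-cancelʳ-< K (a + w) (b + s) (begin-strict
      a + w + K             ≡⟨ unshift a w s≤K ⟨
      a + (K ∸ s) + (s + w) <⟨ +-monoˡ-< (s + w) h ⟩
      b + (K ∸ w) + (s + w) ≡⟨ cong (_+_ (b + (K ∸ w))) (+-comm s w) ⟩
      b + (K ∸ w) + (w + s) ≡⟨ unshift b s w≤K ⟩
      b + s + K             ∎)
      where open ≤-Reasoning

  prime-rotation : ∀ xs → All InRange xs → length xs ≡ suc K →
                   ∃[ s ] s < K × PrimeParkingCounts (map (rot s) xs)
  prime-rotation xs inRange n≡1+K = s , s<K , map⁺ (All.map (proj₁ ∘ rot-inRange s<K) inRange) , counts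
    where
    C : ℕ → ℕ
    C v = atMost v xs

    -- C w − w, shifted by K to avoid truncated subtraction.
    f : ℕ → ℕ
    f w = C w + (K ∸ w)

    open LastArgMin (lastArgMin f K) renaming (arg to s; arg≤N to s≤K)

    s<K : s < K
    s<K = ≤∧≢⇒< s≤K λ s≡K → <-irrefl refl (begin-strict
      K        <⟨ n<1+n K ⟩
      suc K    ≡⟨ ≡-trans (sym n≡1+K) (sym (atMost-K inRange)) ⟩
      C K      ≡⟨ +-identityʳ (C K) ⟨
      C K + 0  ≡⟨ cong (_+_ (C K)) (n∸n≡0 K) ⟨
      f K      ≡⟨ cong f s≡K ⟨
      f s      ≤⟨ minimal z≤n ⟩
      C 0 + K  ≡⟨ cong (_+ K) (atMost-0 inRange) ⟩
      K        ∎)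
      where open ≤-Reasoning

    counts : ∀ {v} → 0 < v → v < length (map (rot s) xs) → v < atMost v (map (rot s) xs)
    counts {v} 0<v v<n with v ≤? K ∸ s
    ... | yes v≤K-s = atMost-rot-low-bound v≤K-s inRange (shift-< s≤K s+v≤K (last (m<m+n s 0<v) s+v≤K))
      where
      s+v≤K : s + v ≤ K
      s+v≤K = ≤-trans (≤-reflexive (+-comm s v)) (m≤o∸n⇒m+n≤o v s≤K v≤K-s)
    ... | no v≰K-s = subst (λ u → u < atMost u (map (rot s) xs)) (m+[n∸m]≡n (<⇒≤ (≰⇒> v≰K-s)))
                           (atMost-rot-high-bound w≤s s≤K inRange n≡1+K (shift-≤ s≤K w≤K (minimal w≤K)))
      where
      w = v ∸ (K ∸ s)
      v≤K : v ≤ K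
      v≤K = s≤s⁻¹ (≤-trans v<n (≤-reflexive (≡-trans (length-map (rot s) xs) n≡1+K)))
      w≤s : w ≤ s
      w≤s = m≤n+o⇒m∸n≤o v (K ∸ s) (≤-trans v≤K (≤-reflexive (sym (m∸n+n≡m s≤K))))
      w≤K : w ≤ K
      w≤K = ≤-trans w≤s s≤K

  -- The entries above s are exactly those rotated to at most K − s, so these two counts sum to K + 1.
  rotation-not-prime : ∀ {s xs} → 0 < s → s < K → All InRange xs → length xs ≡ suc K →
                       PrimeParkingCounts xs → ¬ PrimeParkingCounts (map (rot s) xs)
  rotation-not-prime {s} {xs} 0<s s<K inRange n≡1+K (_ , counts) (_ , rotCounts) = <-irrefl refl (begin
    suc (suc K)                                   ≡⟨ cong (suc ∘ suc) (m∸n+n≡m s≤K) ⟨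
    suc (suc (K ∸ s + s))                         ≡⟨ cong suc (+-suc (K ∸ s) s) ⟨
    suc (K ∸ s) + suc s                           ≤⟨ +-mono-≤ (rotCounts (m<n⇒0<n∸m s<K) K∸s<n) (counts 0<s s<n) ⟩
    atMost (K ∸ s) (map (rot s) xs) + atMost s xs ≡⟨ atMost-rot-low ≤-refl inRange ⟩
    atMost (s + (K ∸ s)) xs                       ≡⟨ cong (λ v → atMost v xs) (m+[n∸m]≡n s≤K) ⟩
    atMost K xs                                   ≡⟨ atMost-K inRange ⟩
    length xs                                     ≡⟨ n≡1+K ⟩
    suc K                                         ∎)
    where
    open ≤-Reasoning
    s≤K = <⇒≤ s<K
    K∸s<n : K ∸ s < length (map (rot s) xs)
    K∸s<n = ≤-trans (s≤s (m∸n≤m K s)) (≤-reflexive (sym (≡-trans (length-map (rot s) xs) n≡1+K)))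
    s<n : s < length xs
    s<n = ≤-trans (m≤n⇒m≤1+n s<K) (≤-reflexive (sym n≡1+K))

-- Congruences modulo K

infix 4 _≡_mod_
-- A record rather than a definition, so that x and y remain inferable from the type.
record _≡_mod_ (x y : ℤ) (K : ℕ) : Set where
  constructor modulus∣
  field ∣difference : + K ∣ x - y
open _≡_mod_

+[m∸n]≡+m-+n : ∀ {m n} → n ≤ m → + (m ∸ n) ≡ + m - + n
+[m∸n]≡+m-+n {m} {n} n≤m = sym (≡-trans (ℤ.m-n≡m⊖n m n) (ℤ.⊖-≥ n≤m))

module _ {K : ℕ} where

  mod-refl : ∀ {x} → x ≡ x mod K
  mod-refl {x} = modulus∣ (divides 0ℤ (ℤ.+-inverseʳ x))

  ≡⇒mod : ∀ {x y} → x ≡ y → x ≡ y mod K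
  ≡⇒mod refl = mod-refl

  mod-resp : ∀ {x y x′ y′} → x - y ≡ x′ - y′ → x ≡ y mod K → x′ ≡ y′ mod K
  mod-resp eq (modulus∣ K∣x-y) = modulus∣ (subst (+ K ∣_) eq K∣x-y)

  mod-sym : ∀ {x y} → x ≡ y mod K → y ≡ x mod K
  mod-sym {x} {y} (modulus∣ K∣x-y) = modulus∣ (subst (+ K ∣_) (negate x y) (∣m⇒∣-m K∣x-y))
    where
    negate : ∀ x y → - (x - y) ≡ y - x
    negate = ℤ-Solver.solve-∀

  mod-trans : ∀ {x y z} → x ≡ y mod K → y ≡ z mod K → x ≡ z mod K
  mod-trans {x} {y} {z} (modulus∣ K∣x-y) (modulus∣ K∣y-z) =
    modulus∣ (subst (+ K ∣_) (telescope x y z) (∣m∣n⇒∣m+n K∣x-y K∣y-z))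
    where
    telescope : ∀ x y z → (x - y) ℤ.+ (y - z) ≡ x - z
    telescope = ℤ-Solver.solve-∀

  mod-cong-+ : ∀ {a b c d} → a ≡ b mod K → c ≡ d mod K → a ℤ.+ c ≡ b ℤ.+ d mod K
  mod-cong-+ {a} {b} {c} {d} (modulus∣ K∣a-b) (modulus∣ K∣c-d) =
    modulus∣ (subst (+ K ∣_) (regroup a b c d) (∣m∣n⇒∣m+n K∣a-b K∣c-d))
    where
    regroup : ∀ a b c d → (a - b) ℤ.+ (c - d) ≡ (a ℤ.+ c) - (b ℤ.+ d)
    regroup = ℤ-Solver.solve-∀

  mod-cong-- : ∀ {a b c d} → a ≡ b mod K → c ≡ d mod K → a - c ≡ b - d mod K
  mod-cong-- {a} {b} {c} {d} (modulus∣ K∣a-b) (modulus∣ K∣c-d) =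
    modulus∣ (subst (+ K ∣_) (regroup a b c d) (∣m∣n⇒∣m-n K∣a-b K∣c-d))
    where
    regroup : ∀ a b c d → (a - b) - (c - d) ≡ (a - c) - (b - d)
    regroup = ℤ-Solver.solve-∀

  mod-setoid : Setoid 0ℓ 0ℓ
  mod-setoid = record
    { Carrier       = ℤ
    ; _≈_           = λ x y → x ≡ y mod K
    ; isEquivalence = record { refl = mod-refl ; sym = mod-sym ; trans = mod-trans }
    }

  multiple<K⇒0 : ∀ {n} → K ∣ℕ n → n < K → n ≡ 0
  multiple<K⇒0 {zero}  _   _   = refl
  multiple<K⇒0 {suc n} K∣n n<K = contradiction (∣⇒≤ K∣n) (<⇒≱ n<K)

  mod⇒≤ : ∀ {a b} → b ≤ a → a < K → + a ≡ + b mod K → a ≤ b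
  mod⇒≤ {a} {b} b≤a a<K (modulus∣ K∣a-b) = m∸n≡0⇒m≤n (multiple<K⇒0
    (∣⇒∣ᵤ (subst (+ K ∣_) (sym (+[m∸n]≡+m-+n b≤a)) K∣a-b)) (≤-<-trans (m∸n≤m a b) a<K))

  mod⇒≡ : ∀ {a b} → a < K → b < K → + a ≡ + b mod K → a ≡ b
  mod⇒≡ {a} {b} a<K b<K a≡b with ≤-total b a
  ... | inj₁ b≤a = ≤-antisym (mod⇒≤ b≤a a<K a≡b) b≤a
  ... | inj₂ a≤b = sym (≤-antisym (mod⇒≤ a≤b b<K (mod-sym a≡b)) a≤b)

  mod-%ℕ : ⦃ _ : NonZero K ⦄ → ∀ z → z ≡ + (z %ℕ K) mod K
  mod-%ℕ z = modulus∣ (divides (z /ℕ K)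
    (≡-trans (cong (_- + (z %ℕ K)) (a≡a%ℕn+[a/ℕn]*n z K)) (cancel (+ (z %ℕ K)) _)))
    where
    cancel : ∀ r t → (r ℤ.+ t) - r ≡ t
    cancel = ℤ-Solver.solve-∀

-- Difference vectors

lookup-ext : ∀ {n} {xs ys : Vec A n} → (∀ i → Vec.lookup xs i ≡ Vec.lookup ys i) → xs ≡ ys
lookup-ext {xs = xs} {ys} eq = ≡-trans (sym (tabulate∘lookup xs)) (≡-trans (tabulate-cong eq) (tabulate∘lookup ys))

module Differences (K : ℕ) ⦃ _ : NonZero K ⦄ where
  open Rotation K

  Δ : ∀ {n} → Vec ℕ (suc n) → Fin n → ℤ
  Δ x i = + Vec.lookup x (fsuc i) - + Vec.lookup x (inject₁ i)

  rep : ℤ → ℕ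
  rep z = suc ((z - 1ℤ) %ℕ K)

  rep-inRange : ∀ z → InRange (rep z)
  rep-inRange z = s≤s z≤n , n%ℕd<d (z - 1ℤ) K

  rep-mod : ∀ z → + rep z ≡ z mod K
  rep-mod z = mod-resp (shift-by-one (+ ((z - 1ℤ) %ℕ K)) z) (mod-sym (mod-%ℕ (z - 1ℤ)))
    where
    shift-by-one : ∀ r z → r - (z - 1ℤ) ≡ (1ℤ ℤ.+ r) - z
    shift-by-one = ℤ-Solver.solve-∀

  walk : ∀ {n} → ℕ → Vec ℕ n → Vec ℕ (suc n)
  walk a []       = a ∷ []
  walk a (d ∷ ds) = a ∷ walk (rep (+ (a + d))) ds

  walk-head : ∀ {n} a (ds : Vec ℕ n) → Vec.lookup (walk a ds) fzero ≡ a
  walk-head a []       = refl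
  walk-head a (d ∷ ds) = refl

  walk-inRange : ∀ {n a} (ds : Vec ℕ n) → InRange a → ∀ j → InRange (Vec.lookup (walk a ds) j)
  walk-inRange []       a∈ fzero              = a∈
  walk-inRange (d ∷ ds) a∈ fzero              = a∈
  walk-inRange {a = a} (d ∷ ds) a∈ (fsuc j) = walk-inRange ds (rep-inRange (+ (a + d))) j

  walk-Δ : ∀ {n} a (ds : Vec ℕ n) i → Δ (walk a ds) i ≡ + Vec.lookup ds i mod K
  walk-Δ a (d ∷ ds) fzero rewrite walk-head (rep (+ (a + d))) ds =
    mod-resp (regroup (+ rep (+ (a + d))) (+ a) (+ d)) (rep-mod (+ (a + d)))
    where
    regroup : ∀ r a d → r - (a ℤ.+ d) ≡ (r - a) - d
    regroup = ℤ-Solver.solve-∀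
  walk-Δ a (d ∷ ds) (fsuc i) = walk-Δ (rep (+ (a + d))) ds i

  rot-mod : ∀ {s x} → s ≤ K → + rot s x ≡ + x - + s mod K
  rot-mod {s} {x} s≤K with x ≤? s
  ... | yes x≤s rewrite rot-≤ x≤s = modulus∣ (divides 1ℤ (begin
    + x ℤ.+ + (K ∸ s) - (+ x - + s) ≡⟨ regroup (+ x) (+ (K ∸ s)) (+ s) ⟩
    + (K ∸ s) ℤ.+ + s               ≡⟨ cong +_ (m∸n+n≡m s≤K) ⟩
    + K                             ≡⟨ ℤ.*-identityˡ (+ K) ⟨
    1ℤ ℤ.* + K                      ∎))
    where
    open ≡-Reasoning
    regroup : ∀ x r s → x ℤ.+ r - (x - s) ≡ r ℤ.+ s
    regroup = ℤ-Solver.solve-∀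
  ... | no x≰s rewrite rot-> (≰⇒> x≰s) = ≡⇒mod (+[m∸n]≡+m-+n (<⇒≤ (≰⇒> x≰s)))

  rot-Δ : ∀ {n s} → s ≤ K → (x : Vec ℕ (suc n)) → ∀ i → Δ (Vec.map (rot s) x) i ≡ Δ x i mod K
  rot-Δ {s = s} s≤K x i rewrite lookup-map (fsuc i) (rot s) x | lookup-map (inject₁ i) (rot s) x =
    mod-trans (mod-cong-- (rot-mod s≤K) (rot-mod s≤K))
              (≡⇒mod (cancel (+ Vec.lookup x (fsuc i)) (+ Vec.lookup x (inject₁ i)) (+ s)))
    where
    cancel : ∀ a b s → (a - s) - (b - s) ≡ a - b
    cancel = ℤ-Solver.solve-∀

  Δ-offset : ∀ {n} (x y : Vec ℕ (suc n)) → (∀ i → Δ y i ≡ Δ x i mod K) → ∀ j →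
             + Vec.lookup y j - + Vec.lookup x j ≡ + Vec.lookup y fzero - + Vec.lookup x fzero mod K
  Δ-offset x y _ fzero = mod-refl
  Δ-offset {suc n} (a ∷ x) (b ∷ y) Δy≡Δx (fsuc j) =
    mod-trans (Δ-offset x y (Δy≡Δx ∘ fsuc) j)
              (mod-resp (regroup (+ Vec.lookup y fzero) (+ b) (+ Vec.lookup x fzero) (+ a)) (Δy≡Δx fzero))
    where
    regroup : ∀ y₀ b x₀ a → (y₀ - b) - (x₀ - a) ≡ (y₀ - x₀) - (b - a)
    regroup = ℤ-Solver.solve-∀

  inRange-mod⇒≡ : ∀ {a b} → InRange a → InRange b → + a ≡ + b mod K → a ≡ b
  inRange-mod⇒≡ {suc a} {suc b} (_ , a<K) (_ , b<K) a≡b =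
    cong suc (mod⇒≡ a<K b<K (mod-resp (cancel-suc (+ a) (+ b)) a≡b))
    where
    cancel-suc : ∀ a b → (1ℤ ℤ.+ a) - (1ℤ ℤ.+ b) ≡ a - b
    cancel-suc = ℤ-Solver.solve-∀

  rotation-match : ∀ {n} {x y : Vec ℕ (suc n)} →
                   (∀ j → InRange (Vec.lookup x j)) → (∀ j → InRange (Vec.lookup y j)) →
                   (∀ i → Δ y i ≡ Δ x i mod K) → ∃[ s ] s < K × y ≡ Vec.map (rot s) x
  rotation-match {x = x} {y} x∈ y∈ Δy≡Δx = s , s<K , lookup-ext λ j →
    ≡-trans (inRange-mod⇒≡ (y∈ j) (rot-inRange s<K (x∈ j)) (y≡rot j)) (sym (lookup-map j (rot s) x))
    where
    x₀ = + Vec.lookup x fzero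
    y₀ = + Vec.lookup y fzero
    s = (x₀ - y₀) %ℕ K
    s<K = n%ℕd<d (x₀ - y₀) K
    y≡rot : ∀ j → + Vec.lookup y j ≡ + rot s (Vec.lookup x j) mod K
    y≡rot j = begin
      yⱼ                       ≡⟨ split yⱼ xⱼ ⟩
      (yⱼ - xⱼ) ℤ.+ xⱼ         ≈⟨ mod-cong-+ (Δ-offset x y Δy≡Δx j) (mod-refl {x = xⱼ}) ⟩
      (y₀ - x₀) ℤ.+ xⱼ         ≡⟨ regroup y₀ x₀ xⱼ ⟩
      xⱼ - (x₀ - y₀)           ≈⟨ mod-cong-- (mod-refl {x = xⱼ}) (mod-%ℕ (x₀ - y₀)) ⟩
      xⱼ - + s                 ≈⟨ rot-mod (<⇒≤ s<K) ⟨
      + rot s (Vec.lookup x j) ∎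
      where
      open SetoidReasoning mod-setoid
      xⱼ = + Vec.lookup x j
      yⱼ = + Vec.lookup y j
      split : ∀ y x → y ≡ (y - x) ℤ.+ x
      split = ℤ-Solver.solve-∀
      regroup : ∀ y₀ x₀ x → (y₀ - x₀) ℤ.+ x ≡ x - (x₀ - y₀)
      regroup = ℤ-Solver.solve-∀

  prime-unique : ∀ {x y : Vec ℕ (suc K)} → (∀ i → Δ y i ≡ Δ x i mod K) →
                 PrimeParkingCounts (toList x) → PrimeParkingCounts (toList y) → y ≡ x
  prime-unique {x} {y} Δy≡Δx x-prime y-prime =
    rotation⇒≡ (rotation-match (inRange x-prime) (inRange y-prime) Δy≡Δx)
    where
    inRange : ∀ {z} → PrimeParkingCounts (toList z) → ∀ j → InRange (Vec.lookup z j)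
    inRange {z} z-prime = Allᵛ.lookup⁺ (Allᵛ.toList⁻ (prime⇒inRange (>-nonZero⁻¹ K) (length-toList z) z-prime))

    rotation⇒≡ : ∃[ s ] s < K × y ≡ Vec.map (rot s) x → y ≡ x
    rotation⇒≡ (zero , _ , y≡x) = ≡-trans y≡x (lookup-ext λ j →
      ≡-trans (lookup-map j (rot 0) x) (rot-> (proj₁ (inRange x-prime j))))
    rotation⇒≡ (suc s , s<K , y≡x) = contradiction
      (subst PrimeParkingCounts (≡-trans (cong toList y≡x) (toList-map (rot (suc s)) x)) y-prime)
      (rotation-not-prime z<s s<K (prime⇒inRange (>-nonZero⁻¹ K) (length-toList x) x-prime) (length-toList x) x-prime)

  -- Opaque: nothing depends on which shift was found, and unfolding its proof is expensive.
  opaque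
    prime-shift : (d : Vec ℕ K) → ∃[ s ] s < K × PrimeParkingCounts (map (rot s) (toList (walk 1 d)))
    prime-shift d = prime-rotation (toList (walk 1 d))
                                   (Allᵛ.toList⁺ (Allᵛ.lookup⁻ (walk-inRange d (≤-refl , >-nonZero⁻¹ K))))
                                   (length-toList (walk 1 d))

  fromResidues : Vec ℕ K → Vec ℕ (suc K)
  fromResidues d = Vec.map (rot (proj₁ (prime-shift d))) (walk 1 d)

  fromResidues-prime : ∀ d → PrimeParkingCounts (toList (fromResidues d))
  fromResidues-prime d = subst PrimeParkingCounts (sym (toList-map _ (walk 1 d))) (proj₂ (proj₂ (prime-shift d)))

  fromResidues-Δ : ∀ d i → Δ (fromResidues d) i ≡ + Vec.lookup d i mod K
  fromResidues-Δ d i = mod-trans (rot-Δ (<⇒≤ (proj₁ (proj₂ (prime-shift d)))) (walk 1 d) i) (walk-Δ 1 d i)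

  residues : ∀ {n} → Vec ℕ (suc n) → Vec ℕ n
  residues x = tabulate λ i → Δ x i %ℕ K

  residues-< : ∀ {n} (x : Vec ℕ (suc n)) i → Vec.lookup (residues x) i < K
  residues-< x i = subst (_< K) (sym (lookup∘tabulate _ i)) (n%ℕd<d (Δ x i) K)

  Δ-residues : ∀ {n} (x : Vec ℕ (suc n)) i → Δ x i ≡ + Vec.lookup (residues x) i mod K
  Δ-residues x i = subst (λ r → Δ x i ≡ + r mod K) (sym (lookup∘tabulate _ i)) (mod-%ℕ (Δ x i))

  residues-fromResidues : ∀ {d} → (∀ i → Vec.lookup d i < K) → residues (fromResidues d) ≡ d
  residues-fromResidues {d} d<K = lookup-ext λ i → mod⇒≡ (residues-< (fromResidues d) i) (d<K i)
    (mod-trans (mod-sym (Δ-residues (fromResidues d) i)) (fromResidues-Δ d i))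

  fromResidues-residues : ∀ {π} → PrimeParkingCounts (toList π) → fromResidues (residues π) ≡ π
  fromResidues-residues {π} π-prime = prime-unique
    (λ i → mod-trans (fromResidues-Δ (residues π) i) (mod-sym (Δ-residues π i)))
    π-prime (fromResidues-prime (residues π))

-- Finite cardinalities

module _ {P Q : A → Set} where

  HasCardinality-resp : ∀ {N} → (∀ x → P x ⇔ Q x) → HasCardinality P N → HasCardinality Q N
  HasCardinality-resp P⇔Q (L , L! , L⇔P , |L|≡N) = L , L! , (λ x → ⇔-trans (L⇔P x) (P⇔Q x)) , |L|≡N

HasCardinality-[] : ∀ {P : Vec A 0 → Set} → P [] → HasCardinality P 1
HasCardinality-[] P[] = [] ∷ [] , [] ∷ [] , (λ { [] → mk⇔ (λ _ → P[]) (λ _ → here refl) }) , refl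

HasCardinality-≡ : ∀ (a : A) → HasCardinality (_≡ a) 1
HasCardinality-≡ a = a ∷ [] , [] ∷ [] , (λ x → mk⇔ (λ { (here x≡a) → x≡a ; (there ()) }) here) , refl

HasCardinality-< : ∀ K → HasCardinality (_< K) K
HasCardinality-< K = upTo K , Unique.upTo⁺ K , (λ x → mk⇔ ∈-upTo⁻ ∈-upTo⁺) , length-upTo K

module _ (_≟_ : DecidableEquality A) where

  length-filter-≢ : ∀ {a xs} → Unique xs → a ∈ xs →
                    suc (length (filter (λ x → ¬? (x ≟ a)) xs)) ≡ length xs
  length-filter-≢ {a} {x ∷ xs} (x∉xs ∷ _) (here refl)
    rewrite filter-reject (λ x → ¬? (x ≟ a)) {x} {xs} (λ x≢a → x≢a refl) =
    cong (suc ∘ length) (filter-all (λ x → ¬? (x ≟ a)) (All.map (λ x≢y y≡x → x≢y (sym y≡x)) x∉xs))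
  length-filter-≢ {a} {x ∷ xs} (x∉xs ∷ xs!) (there a∈xs)
    rewrite filter-accept (λ x → ¬? (x ≟ a)) {x} {xs} (All.lookup x∉xs a∈xs) =
    cong suc (length-filter-≢ xs! a∈xs)

  HasCardinality-remove : ∀ {P : A → Set} {N a} → HasCardinality P N → P a →
                          HasCardinality (λ x → P x × x ≢ a) (N ∸ 1)
  HasCardinality-remove {P = P} {a = a} (L , L! , L⇔P , |L|≡N) Pa =
    filter (λ x → ¬? (x ≟ a)) L ,
    Unique.filter⁺ (λ x → ¬? (x ≟ a)) L! ,
    (λ x → mk⇔ (λ x∈ → Product.map₁ (Equivalence.to (L⇔P x)) (∈-filter⁻ (λ x → ¬? (x ≟ a)) x∈))
               (λ (Px , x≢a) → ∈-filter⁺ (λ x → ¬? (x ≟ a)) (Equivalence.from (L⇔P x) Px) x≢a)) ,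
    cong (_∸ 1) (≡-trans (length-filter-≢ L! (Equivalence.from (L⇔P a) Pa)) |L|≡N)

length-cartesianProductWith : ∀ {C : Set} (f : A → B → C) xs ys →
                              length (cartesianProductWith f xs ys) ≡ length xs * length ys
length-cartesianProductWith f []       ys = refl
length-cartesianProductWith f (x ∷ xs) ys = begin
  length (map (f x) ys ++ cartesianProductWith f xs ys)         ≡⟨ length-++ (map (f x) ys) ⟩
  length (map (f x) ys) + length (cartesianProductWith f xs ys) ≡⟨ cong₂ _+_ (length-map (f x) ys)
                                                                          (length-cartesianProductWith f xs ys) ⟩
  length ys + length xs * length ys                             ∎
  where open ≡-Reasoning

HasCardinality-∷ : ∀ {n} {P : A → Set} {Q : Vec A n → Set} {a b} →
                   HasCardinality P a → HasCardinality Q b →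
                   HasCardinality (λ v → P (Vec.head v) × Q (Vec.tail v)) (a * b)
HasCardinality-∷ {P = P} {Q} (L , L! , L⇔P , |L|≡a) (M , M! , M⇔Q , |M|≡b) =
  cartesianProductWith _∷_ L M ,
  Unique.cartesianProductWith⁺ _∷_ ∷-injective L! M! ,
  (λ { (x ∷ v) → mk⇔ (∈⇒PQ x v) λ (Px , Qv) →
         ∈-cartesianProductWith⁺ _∷_ (Equivalence.from (L⇔P x) Px) (Equivalence.from (M⇔Q v) Qv) }) ,
  ≡-trans (length-cartesianProductWith _∷_ L M) (cong₂ _*_ |L|≡a |M|≡b)
  where
  ∈⇒PQ : ∀ x v → x ∷ v ∈ cartesianProductWith _∷_ L M → P x × Q v
  ∈⇒PQ x v x∷v∈ with ∈-cartesianProductWith⁻ _∷_ L M x∷v∈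
  ... | y , w , y∈L , w∈M , refl = Equivalence.to (L⇔P y) y∈L , Equivalence.to (M⇔Q w) w∈M

HasCardinality-bijection : ∀ {P : B → Set} {Q : A → Set} {N} (f : A → B) (g : B → A) →
                           (∀ {a} → Q a → P (f a) × g (f a) ≡ a) → (∀ {b} → P b → Q (g b) × f (g b) ≡ b) →
                           HasCardinality Q N → HasCardinality P N
HasCardinality-bijection {P = P} {Q} f g to from (L , L! , L⇔Q , |L|≡N) =
  map f L , map-unique , (λ b → mk⇔ (∈⇒P b) (P⇒∈ b)) , ≡-trans (length-map f L) |L|≡N
  where
  map-unique : Unique (map f L)
  map-unique = Unique.map⁻ {f = g} (subst Unique (sym (≡-trans (sym (map-∘ L))
                 (map-id-local (All.tabulate (λ {a} a∈L → proj₂ (to (Equivalence.to (L⇔Q a) a∈L))))))) L!)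
  ∈⇒P : ∀ b → b ∈ map f L → P b
  ∈⇒P b b∈ with ∈-map⁻ f b∈
  ... | a , a∈L , refl = proj₁ (to (Equivalence.to (L⇔Q a) a∈L))
  P⇒∈ : ∀ b → P b → b ∈ map f L
  P⇒∈ b Pb = subst (_∈ map f L) (proj₂ (from Pb)) (∈-map⁺ f (Equivalence.from (L⇔Q (g b)) (proj₁ (from Pb))))

does≡true⇔ : ∀ {P : Set} (p? : Dec P) → does p? ≡ true ⇔ P
does≡true⇔ (yes p) = mk⇔ (λ _ → p) (λ _ → refl)
does≡true⇔ (no ¬p) = mk⇔ (λ ()) (λ p → contradiction p ¬p)

does≡false⇔ : ∀ {P : Set} (p? : Dec P) → does p? ≡ false ⇔ (¬ P)
does≡false⇔ (yes p) = mk⇔ (λ ()) (λ ¬p → contradiction p ¬p)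
does≡false⇔ (no ¬p) = mk⇔ (λ _ → ¬p) (λ _ → refl)

∣p∣+∣q∣≤n : ∀ {n} (p q : Subset n) → Empty (p ∩ q) → ∣ p ∣ + ∣ q ∣ ≤ n
∣p∣+∣q∣≤n []          []          _     = z≤n
∣p∣+∣q∣≤n (true ∷ p)  (true ∷ q)  p∩q=∅ = contradiction (fzero , here) p∩q=∅
∣p∣+∣q∣≤n (true ∷ p)  (false ∷ q) p∩q=∅ = s≤s (∣p∣+∣q∣≤n p q (drop-∷-Empty p∩q=∅))
∣p∣+∣q∣≤n (false ∷ p) (true ∷ q)  p∩q=∅ =
  ≤-trans (≤-reflexive (+-suc ∣ p ∣ ∣ q ∣)) (s≤s (∣p∣+∣q∣≤n p q (drop-∷-Empty p∩q=∅)))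
∣p∣+∣q∣≤n (false ∷ p) (false ∷ q) p∩q=∅ = m≤n⇒m≤1+n (∣p∣+∣q∣≤n p q (drop-∷-Empty p∩q=∅))

levelSet : ∀ {n} → ℕ → Vec ℕ n → Subset n
levelSet e = Vec.map (λ x → does (x ≟ e))

module LevelSets (K m ℓ : ℕ) (m<K : m < K) (ℓ<K : ℓ < K) (m≢ℓ : m ≢ ℓ) where

  InLevels : Bool → Bool → ℕ → Set
  InLevels s t x = x < K × does (x ≟ m) ≡ s × does (x ≟ ℓ) ≡ t

  HasLevelSets : ∀ {n} → Subset n → Subset n → Vec ℕ n → Set
  HasLevelSets S T d = (∀ i → Vec.lookup d i < K) × levelSet m d ≡ S × levelSet ℓ d ≡ T

  inLevel-m : HasCardinality (InLevels true false) 1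
  inLevel-m = HasCardinality-resp
    (λ x → mk⇔ (λ { refl → m<K , Equivalence.from (does≡true⇔ (m ≟ m)) refl
                                 , Equivalence.from (does≡false⇔ (m ≟ ℓ)) m≢ℓ })
               (λ (_ , x≟m , _) → Equivalence.to (does≡true⇔ (x ≟ m)) x≟m))
    (HasCardinality-≡ m)

  inLevel-ℓ : HasCardinality (InLevels false true) 1
  inLevel-ℓ = HasCardinality-resp
    (λ x → mk⇔ (λ { refl → ℓ<K , Equivalence.from (does≡false⇔ (ℓ ≟ m)) (m≢ℓ ∘ sym)
                                 , Equivalence.from (does≡true⇔ (ℓ ≟ ℓ)) refl })
               (λ (_ , _ , x≟ℓ) → Equivalence.to (does≡true⇔ (x ≟ ℓ)) x≟ℓ))
    (HasCardinality-≡ ℓ)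

  inNeitherLevel : HasCardinality (InLevels false false) (K ∸ 2)
  inNeitherLevel = subst (HasCardinality (InLevels false false)) (∸-+-assoc K 1 1) (HasCardinality-resp
    (λ x → mk⇔ (λ ((x<K , x≢m) , x≢ℓ) → x<K , Equivalence.from (does≡false⇔ (x ≟ m)) x≢m
                                           , Equivalence.from (does≡false⇔ (x ≟ ℓ)) x≢ℓ)
               (λ (x<K , x≟m , x≟ℓ) → (x<K , Equivalence.to (does≡false⇔ (x ≟ m)) x≟m)
                                     , Equivalence.to (does≡false⇔ (x ≟ ℓ)) x≟ℓ))
    (HasCardinality-remove _≟_ (HasCardinality-remove _≟_ (HasCardinality-< K) m<K) (ℓ<K , m≢ℓ ∘ sym)))

  HasLevelSets-∷ : ∀ {n s t} {S T : Subset n} v →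
                   (InLevels s t (Vec.head v) × HasLevelSets S T (Vec.tail v)) ⇔ HasLevelSets (s ∷ S) (t ∷ T) v
  HasLevelSets-∷ (x ∷ d) = mk⇔
    (λ ((x<K , x≟m , x≟ℓ) , (d<K , dₘ≡S , dₗ≡T)) →
      (λ { fzero → x<K ; (fsuc i) → d<K i }) , cong₂ _∷_ x≟m dₘ≡S , cong₂ _∷_ x≟ℓ dₗ≡T)
    (λ (v<K , vₘ≡sS , vₗ≡tT) →
      (v<K fzero , proj₁ (∷-injective vₘ≡sS) , proj₁ (∷-injective vₗ≡tT)) ,
      (v<K ∘ fsuc , proj₂ (∷-injective vₘ≡sS) , proj₂ (∷-injective vₗ≡tT)))

  HasLevelSets-cardinality : ∀ {n} (S T : Subset n) → Empty (S ∩ T) →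
                             HasCardinality (HasLevelSets S T) ((K ∸ 2) ^ (n ∸ (∣ S ∣ + ∣ T ∣)))
  HasLevelSets-cardinality [] [] _ = HasCardinality-[] ((λ ()) , refl , refl)
  HasLevelSets-cardinality (true ∷ S) (true ∷ T) S∩T=∅ = contradiction (fzero , here) S∩T=∅
  HasLevelSets-cardinality (true ∷ S) (false ∷ T) S∩T=∅ =
    subst (HasCardinality (HasLevelSets (true ∷ S) (false ∷ T))) (*-identityˡ _)
      (HasCardinality-resp HasLevelSets-∷
        (HasCardinality-∷ inLevel-m (HasLevelSets-cardinality S T (drop-∷-Empty S∩T=∅))))
  HasLevelSets-cardinality {suc n} (false ∷ S) (true ∷ T) S∩T=∅ =
    subst (HasCardinality (HasLevelSets (false ∷ S) (true ∷ T)))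
          (≡-trans (*-identityˡ _) (cong (λ k → (K ∸ 2) ^ (suc n ∸ k)) (sym (+-suc ∣ S ∣ ∣ T ∣))))
      (HasCardinality-resp HasLevelSets-∷
        (HasCardinality-∷ inLevel-ℓ (HasLevelSets-cardinality S T (drop-∷-Empty S∩T=∅))))
  HasLevelSets-cardinality {suc n} (false ∷ S) (false ∷ T) S∩T=∅ =
    subst (HasCardinality (HasLevelSets (false ∷ S) (false ∷ T)))
          (cong ((K ∸ 2) ^_) (sym (+-∸-assoc 1 (∣p∣+∣q∣≤n S T (drop-∷-Empty S∩T=∅)))))
      (HasCardinality-resp HasLevelSets-∷
        (HasCardinality-∷ inNeitherLevel (HasLevelSets-cardinality S T (drop-∷-Empty S∩T=∅))))

module Enumeration (K m ℓ : ℕ) ⦃ _ : NonZero K ⦄ (m<K : m < K) (ℓ<K : ℓ < K) (m≢ℓ : m ≢ ℓ) where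
  open Differences K
  open LevelSets K m ℓ m<K ℓ<K m≢ℓ

  SetDiff-levelSet : ∀ {e} → e < K → ∀ π → SetDiff K e π ≡ levelSet e (residues π)
  SetDiff-levelSet {e} e<K π = lookup-ext λ i → begin
    Vec.lookup (SetDiff K e π) i           ≡⟨ lookup∘tabulate _ i ⟩
    does (K ∣? ℤ.∣ Δ π i - + e ∣)          ≡⟨ does-⇔ (divides⇔ i) (K ∣? _) (_ ≟ e) ⟩
    does (Vec.lookup (residues π) i ≟ e)   ≡⟨ lookup-map i _ (residues π) ⟨
    Vec.lookup (levelSet e (residues π)) i ∎
    where
    open ≡-Reasoning
    divides⇔ : ∀ i → K ∣ℕ ℤ.∣ Δ π i - + e ∣ ⇔ Vec.lookup (residues π) i ≡ e
    divides⇔ i = mk⇔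
      (λ K∣ → mod⇒≡ (residues-< π i) e<K (mod-trans (mod-sym (Δ-residues π i)) (modulus∣ (∣ᵤ⇒∣ K∣))))
      (λ rᵢ≡e → ∣⇒∣ᵤ (∣difference (mod-trans (Δ-residues π i) (≡⇒mod (cong +_ rᵢ≡e)))))

  PPF⇔counts : ∀ π → PPF (suc K) π ⇔ PrimeParkingCounts (toList π)
  PPF⇔counts π = prime⇔counts (toList π) (≤-trans (s≤s (>-nonZero⁻¹ K)) (≤-reflexive (sym (length-toList π))))

  SetDiff-fromResidues : ∀ {e d} → e < K → (∀ i → Vec.lookup d i < K) → SetDiff K e (fromResidues d) ≡ levelSet e d
  SetDiff-fromResidues {e} {d} e<K d<K =
    ≡-trans (SetDiff-levelSet e<K (fromResidues d)) (cong (levelSet e) (residues-fromResidues d<K))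

  PPF-cardinality : (S T : Subset K) → Empty (S ∩ T) →
    HasCardinality (λ π → PPF (suc K) π × SetDiff K m π ≡ S × SetDiff K ℓ π ≡ T)
                   ((K ∸ 2) ^ (K ∸ (∣ S ∣ + ∣ T ∣)))
  PPF-cardinality S T S∩T=∅ =
    HasCardinality-bijection fromResidues residues fromResidues-sound residues-sound
                             (HasLevelSets-cardinality S T S∩T=∅)
    where
    P : Vec ℕ (suc K) → Set
    P π = PPF (suc K) π × SetDiff K m π ≡ S × SetDiff K ℓ π ≡ T

    fromResidues-sound : ∀ {d} → HasLevelSets S T d → P (fromResidues d) × residues (fromResidues d) ≡ d
    fromResidues-sound {d} (d<K , dₘ≡S , dₗ≡T) =
      (Equivalence.from (PPF⇔counts (fromResidues d)) (fromResidues-prime d) ,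
       ≡-trans (SetDiff-fromResidues m<K d<K) dₘ≡S , ≡-trans (SetDiff-fromResidues ℓ<K d<K) dₗ≡T) ,
      residues-fromResidues d<K

    residues-sound : ∀ {π} → P π → HasLevelSets S T (residues π) × fromResidues (residues π) ≡ π
    residues-sound {π} (π-ppf , πₘ≡S , πₗ≡T) =
      (residues-< π ,
       ≡-trans (sym (SetDiff-levelSet m<K π)) πₘ≡S , ≡-trans (sym (SetDiff-levelSet ℓ<K π)) πₗ≡T) ,
      fromResidues-residues (Equivalence.to (PPF⇔counts π) π-ppf)

theorem6p5 : (k m ℓ : ℕ) → m ≢ ℓ → m ≤ k ∸ 1 → ℓ ≤ k ∸ 1 →
    (S T : Subset k) → Empty (S ∩ T) →
    HasCardinality (λ (π : Vec ℕ (suc k)) →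
        PPF (suc k) π × SetDiff k m π ≡ S × SetDiff k ℓ π ≡ T)
      ((k ∸ 2) ^ (k ∸ ∣ S ∣ ∸ ∣ T ∣))
theorem6p5 zero    m ℓ m≢ℓ m≤0 ℓ≤0 S T S∩T=∅ =
  contradiction (≡-trans (n≤0⇒n≡0 m≤0) (sym (n≤0⇒n≡0 ℓ≤0))) m≢ℓ
theorem6p5 (suc k) m ℓ m≢ℓ m≤k ℓ≤k S T S∩T=∅ =
  subst (HasCardinality _) (cong ((k ∸ 1) ^_) (sym (∸-+-assoc (suc k) ∣ S ∣ ∣ T ∣)))
    (Enumeration.PPF-cardinality (suc k) m ℓ (s≤s m≤k) (s≤s ℓ≤k) m≢ℓ S T S∩T=∅)
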